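{- Let $\Gamma_{1}=(V_{1},W_{1},E_{1})$ and $\Gamma_{2}=(V_{2},W_{2},E_{2})$ be two bipartite graphs, and let $\mathcal{E}_{1}$ and $\mathcal{E}_{2}$ be strong edge colorings of $\Gamma_{1}$ and $\Gamma_{2}$, respectively, both with colors from the same set $\mathcal{S}$. Define \begin{align*} V &= W_{1},\\ W &= \{(x,u)\in V_{1}\times V_{2}\mid (x,y,s)\in\mathcal{E}_{1}\text{ and }(u,v,s)\in\mathcal{E}_{2}\text{ for some }y\in W_{1},\,v\in W_{2},\,s\in\mathcal{S}\},\\ E &= \{(y,(x,u))\in V\times W\mid (x,y,s)\in\mathcal{E}_{1}\text{ and }(u,v,s)\in\mathcal{E}_{2}\text{ for some }s\in\mathcal{S},\,v\in W_{2}\}. \end{align*} Then \[\mathcal{E}=\{(y,(x,u),(s,v))\mid (x,y,s)\in\mathcal{E}_{1}\text{ and }(u,v,s)\in\mathcal{E}_{2}\}\] is a strong edge coloring of the bipartite graph $\Gamma=(V,W,E)$ with colors from \[\Sigma=\{(s,v)\in\mathcal{S}\times W_{2}\mid (u,v,s)\in\mathcal{E}_{2}\text{ for some }u\in V_{2}\}.\]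
   Context: A bipartite graph is written $(V_1,V_2,E)$ with $V_1\cap V_2=\emptyset$ and $E\subseteq V_1\times V_2$. An edge coloring of a bipartite graph $(V_1,V_2,E)$ with colors from a set $\mathcal{S}$ is identified with the set of triples $\{(v_1,v_2,s)\in V_1\times V_2\times\mathcal{S}\mid (v_1,v_2)\in E \text{ has color } s\}$, each edge receiving exactly one color; it is a (proper) edge coloring if no two edges sharing a vertex have the same color. It is a strong edge coloring if in addition no two edges of the same color are joined by an edge, i.e. any two distinct edges of the same color are vertex-disjoint and there is no edge of the graph having one endpoint on each of them. -}

module Defs where

open import Data.Product using (Σ; ∃; ∃-syntax; _×_; _,_)
open import Relation.Binary.PropositionalEquality using (_≡_; _≢_)
open import Relation.Nullary using (¬_)

-- A bipartite graph (V₁, V₂, E): vertex sets V₁ ⊆ A, V₂ ⊆ B given as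
-- predicates on ambient types A, B (so V₁ ∩ V₂ = ∅ is automatic), and an
-- edge relation E ⊆ V₁ × V₂.
record BipGraph (A B : Set) : Set₁ where
  field
    V₁ : A → Set
    V₂ : B → Set
    E  : A → B → Set
    E⊆ : ∀ {x y} → E x y → V₁ x × V₂ y
open BipGraph public

IsColoring : {A B C : Set} → BipGraph A B → (C → Set) → (A → B → C → Set) → Set
IsColoring {A} {B} {C} Γ 𝒮 𝓔 =
  (∀ x y s → 𝓔 x y s → E Γ x y × 𝒮 s)
  × (∀ x y → E Γ x y → Σ C λ s → 𝓔 x y s × (∀ s′ → 𝓔 x y s′ → s′ ≡ s))

IsEdgeColoring : {A B C : Set} → BipGraph A B → (C → Set) → (A → B → C → Set) → Set
IsEdgeColoring {A} {B} {C} Γ 𝒮 𝓔 =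
  IsColoring Γ 𝒮 𝓔
  × (∀ x y y′ s → 𝓔 x y s → 𝓔 x y′ s → y ≡ y′)
  × (∀ x x′ y s → 𝓔 x y s → 𝓔 x′ y s → x ≡ x′)

IsStrongEdgeColoring : {A B C : Set} → BipGraph A B → (C → Set) → (A → B → C → Set) → Set
IsStrongEdgeColoring {A} {B} {C} Γ 𝒮 𝓔 =
  IsEdgeColoring Γ 𝒮 𝓔
  × (∀ x y x′ y′ s → 𝓔 x y s → 𝓔 x′ y′ s → (x , y) ≢ (x′ , y′) →
       (x ≢ x′) × (y ≢ y′) × ¬ E Γ x y′ × ¬ E Γ x′ y)

module Construction {A₁ B₁ A₂ B₂ C : Set}
  (Γ₁ : BipGraph A₁ B₁) (Γ₂ : BipGraph A₂ B₂)
  (𝓔₁ : A₁ → B₁ → C → Set) (𝓔₂ : A₂ → B₂ → C → Set) where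

  Vᴳ : B₁ → Set
  Vᴳ y = V₂ Γ₁ y

  Wᴳ : A₁ × A₂ → Set
  Wᴳ (x , u) = V₁ Γ₁ x × V₁ Γ₂ u ×
    (∃[ y ] ∃[ v ] ∃[ s ] (V₂ Γ₁ y × V₂ Γ₂ v × 𝓔₁ x y s × 𝓔₂ u v s))

  Eᴳ : B₁ → A₁ × A₂ → Set
  Eᴳ y (x , u) = Vᴳ y × Wᴳ (x , u) ×
    (∃[ s ] ∃[ v ] (V₂ Γ₂ v × 𝓔₁ x y s × 𝓔₂ u v s))

  Γ : BipGraph B₁ (A₁ × A₂)
  Γ = record { V₁ = Vᴳ ; V₂ = Wᴳ ; E = Eᴳ ; E⊆ = λ { (p , q , _) → p , q } }

  𝓔 : B₁ → A₁ × A₂ → C × B₂ → Set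
  𝓔 y (x , u) (s , v) = 𝓔₁ x y s × 𝓔₂ u v s

  Σᶜ : (C → Set) → C × B₂ → Set
  Σᶜ 𝒮 (s , v) = 𝒮 s × V₂ Γ₂ v × (∃[ u ] (V₁ Γ₂ u × 𝓔₂ u v s))

-- In the new graph an edge (y,(x,u)) of colour (s,v) is a pair of edges
-- x—y of Γ₁ and u—v of Γ₂ with the common colour s.  Two edges of colour
-- (s,v) share the edge u—v, since in a proper colouring of Γ₂ the vertex v
-- has at most one edge of colour s; they therefore differ only in their
-- Γ₁-edges, which have the same colour s, so all the separation conditions
-- are inherited from the strong colouring of Γ₁.
module Submission where

open import Defs
open import Data.Product using (Σ; _×_; _,_; proj₁; proj₂)
open import Relation.Binary.PropositionalEquality using (_≡_; _≢_; refl; cong; cong₂; trans; sym)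
open import Relation.Nullary using (¬_)

module _ {A B C : Set} (Γ : BipGraph A B) {𝒮 : C → Set} {𝓔 : A → B → C → Set}
         (colouring : IsColoring Γ 𝒮 𝓔) where

  coloured⇒edge : ∀ {x y s} → 𝓔 x y s → E Γ x y
  coloured⇒edge {x} {y} {s} e = proj₁ (proj₁ colouring x y s e)

  colour-unique : ∀ {x y s s′} → 𝓔 x y s → 𝓔 x y s′ → s′ ≡ s
  colour-unique {x} {y} {s} {s′} e e′ = trans (unique s′ e′) (sym (unique s e))
    where unique = proj₂ (proj₂ (proj₂ colouring x y (coloured⇒edge e)))

module _ {A₁ B₁ A₂ B₂ C : Set} (Γ₁ : BipGraph A₁ B₁) (Γ₂ : BipGraph A₂ B₂)
         {𝒮 : C → Set} (𝓔₁ : A₁ → B₁ → C → Set) (𝓔₂ : A₂ → B₂ → C → Set) where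

  open Construction Γ₁ Γ₂ 𝓔₁ 𝓔₂

  module _ (colouring₁ : IsColoring Γ₁ 𝒮 𝓔₁) where

    edge⇒edge₁ : ∀ {y x u} → Eᴳ y (x , u) → E Γ₁ x y
    edge⇒edge₁ (_ , _ , _ , _ , _ , e₁ , _) = coloured⇒edge Γ₁ colouring₁ e₁

    𝓔-isColoring : IsEdgeColoring Γ₂ 𝒮 𝓔₂ → IsColoring Γ (Σᶜ 𝒮) 𝓔
    𝓔-isColoring (colouring₂ , sameColour⇒sameEnd₂ , _) = sound , total
      where
      sound : ∀ y w c → 𝓔 y w c → Eᴳ y w × Σᶜ 𝒮 c
      sound y (x , u) (s , v) (e₁ , e₂) =
        (y∈W₁ , (x∈V₁ , u∈V₂ , y , v , s , y∈W₁ , v∈W₂ , e₁ , e₂) , s , v , v∈W₂ , e₁ , e₂)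
        , s∈𝒮 , v∈W₂ , u , u∈V₂ , e₂
        where
        s∈𝒮 = proj₂ (proj₁ colouring₁ x y s e₁)
        x∈V₁ = proj₁ (E⊆ Γ₁ (coloured⇒edge Γ₁ colouring₁ e₁))
        y∈W₁ = proj₂ (E⊆ Γ₁ (coloured⇒edge Γ₁ colouring₁ e₁))
        u∈V₂ = proj₁ (E⊆ Γ₂ (coloured⇒edge Γ₂ colouring₂ e₂))
        v∈W₂ = proj₂ (E⊆ Γ₂ (coloured⇒edge Γ₂ colouring₂ e₂))

      total : ∀ y w → Eᴳ y w → Σ (C × B₂) λ c → 𝓔 y w c × (∀ c′ → 𝓔 y w c′ → c′ ≡ c)
      total y (x , u) (_ , _ , s , v , _ , e₁ , e₂) = (s , v) , (e₁ , e₂) , unique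
        where
        unique : ∀ c′ → 𝓔 y (x , u) c′ → c′ ≡ (s , v)
        unique (s′ , v′) (e₁′ , e₂′) with colour-unique Γ₁ colouring₁ e₁ e₁′
        ... | refl = cong (s ,_) (sameColour⇒sameEnd₂ u v′ v s e₂′ e₂)

  sameColour⇒sameStart₂ : IsEdgeColoring Γ₂ 𝒮 𝓔₂ →
    ∀ {y y′ x x′ u u′ c} → 𝓔 y (x , u) c → 𝓔 y′ (x′ , u′) c → u ≡ u′
  sameColour⇒sameStart₂ (_ , _ , sameColour⇒sameStart) {u = u} {u′} {s , v} (_ , e₂) (_ , e₂′) =
    sameColour⇒sameStart u u′ v s e₂ e₂′

  𝓔-isEdgeColoring : IsEdgeColoring Γ₁ 𝒮 𝓔₁ → IsEdgeColoring Γ₂ 𝒮 𝓔₂ →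
    IsEdgeColoring Γ (Σᶜ 𝒮) 𝓔
  𝓔-isEdgeColoring proper₁@(colouring₁ , sameColour⇒sameEnd₁ , sameColour⇒sameStart₁) proper₂ =
    𝓔-isColoring colouring₁ proper₂ , sameColour⇒sameEnd , sameColour⇒sameStart
    where
    sameColour⇒sameEnd : ∀ y w w′ c → 𝓔 y w c → 𝓔 y w′ c → w ≡ w′
    sameColour⇒sameEnd y (x , u) (x′ , u′) (s , v) e@(e₁ , _) e′@(e₁′ , _) =
      cong₂ _,_ (sameColour⇒sameStart₁ x x′ y s e₁ e₁′) (sameColour⇒sameStart₂ proper₂ e e′)

    sameColour⇒sameStart : ∀ y y′ w c → 𝓔 y w c → 𝓔 y′ w c → y ≡ y′
    sameColour⇒sameStart y y′ (x , u) (s , v) (e₁ , _) (e₁′ , _) =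
      sameColour⇒sameEnd₁ x y y′ s e₁ e₁′

  𝓔-isStrongEdgeColoring : IsStrongEdgeColoring Γ₁ 𝒮 𝓔₁ → IsEdgeColoring Γ₂ 𝒮 𝓔₂ →
    IsStrongEdgeColoring Γ (Σᶜ 𝒮) 𝓔
  𝓔-isStrongEdgeColoring (proper₁@(colouring₁ , _) , strong₁) proper₂ =
    𝓔-isEdgeColoring proper₁ proper₂ , strong
    where
    strong : ∀ y w y′ w′ c → 𝓔 y w c → 𝓔 y′ w′ c → (y , w) ≢ (y′ , w′) →
      (y ≢ y′) × (w ≢ w′) × ¬ Eᴳ y w′ × ¬ Eᴳ y′ w
    strong y (x , u) y′ (x′ , u′) (s , v) e@(e₁ , _) e′@(e₁′ , _) distinct
      with sameColour⇒sameStart₂ proper₂ e e′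
    ... | refl =
      y≢y′ , (λ { refl → x≢x′ refl })
      , (λ y—w′ → ¬x′—y (edge⇒edge₁ colouring₁ y—w′))
      , (λ y′—w → ¬x—y′ (edge⇒edge₁ colouring₁ y′—w))
      where
      separated = strong₁ x y x′ y′ s e₁ e₁′ λ { refl → distinct refl }
      x≢x′ = proj₁ separated
      y≢y′ = proj₁ (proj₂ separated)
      ¬x—y′ = proj₁ (proj₂ (proj₂ separated))
      ¬x′—y = proj₂ (proj₂ (proj₂ separated))

lemma2 : {A₁ B₁ A₂ B₂ C : Set} (Γ₁ : BipGraph A₁ B₁) (Γ₂ : BipGraph A₂ B₂)
    (𝒮 : C → Set) (𝓔₁ : A₁ → B₁ → C → Set) (𝓔₂ : A₂ → B₂ → C → Set) →
    IsStrongEdgeColoring Γ₁ 𝒮 𝓔₁ → IsStrongEdgeColoring Γ₂ 𝒮 𝓔₂ →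
    IsStrongEdgeColoring (Construction.Γ Γ₁ Γ₂ 𝓔₁ 𝓔₂)
      (Construction.Σᶜ Γ₁ Γ₂ 𝓔₁ 𝓔₂ 𝒮) (Construction.𝓔 Γ₁ Γ₂ 𝓔₁ 𝓔₂)
lemma2 Γ₁ Γ₂ _ 𝓔₁ 𝓔₂ strong₁ (proper₂ , _) = 𝓔-isStrongEdgeColoring Γ₁ Γ₂ 𝓔₁ 𝓔₂ strong₁ proper₂
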